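{- Let $m,n\ge 0$ be integers and let $T_{m,n}$ be the square torus grid of dimension $(4m+2)\times(4n+2)$, i.e. the set of cells $\mathbb{Z}/(4m+2)\mathbb{Z}\times\mathbb{Z}/(4n+2)\mathbb{Z}$. Then $T_{m,n}$ cannot be tiled by X-hexominoes.
   Context: The X-hexomino is the polyomino $\{(0,0),(0,1),(0,2),(0,3),(1,1),(-1,1)\}\subset\mathbb{Z}^2$ (a row of four unit squares together with one square directly above and one square directly below the second square of the row). A placement of a polyomino $P\subset\mathbb{Z}^2$ on the torus grid is the image of $g(P)+v$ under the reduction map $\mathbb{Z}^2\to\mathbb{Z}/(4m+2)\mathbb{Z}\times\mathbb{Z}/(4n+2)\mathbb{Z}$, where $g$ is a rotation or reflection of the square lattice (an element of the dihedral group of order 8 acting on $\mathbb{Z}^2$) and $v\in\mathbb{Z}^2$, provided that this image consists of $|P|$ distinct cells. A tiling of the torus grid by a polyomino is a collection of placements of that polyomino whose cell sets partition the set of all cells. -}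

module Defs where

open import Data.Bool using (Bool; true; false; if_then_else_)
open import Data.Nat using (ℕ; suc; _+_; _*_; _<_)
open import Data.Integer using (ℤ; +_; -[1+_]; -_; _%ℕ_) renaming (_+_ to _+ℤ_)
open import Data.Product using (_×_; _,_; Σ; proj₁; proj₂)
open import Data.List using (List; []; _∷_; map; length; lookup)
open import Data.List.Relation.Unary.Any using (Any)
open import Data.List.Relation.Unary.AllPairs using (AllPairs)
open import Data.Fin using (Fin)
open import Relation.Binary.PropositionalEquality using (_≡_)
open import Relation.Nullary using (¬_)

Polyomino : Set
Polyomino = List (ℤ × ℤ)

X-hexomino : Polyomino
X-hexomino = (+ 0 , + 0) ∷ (+ 0 , + 1) ∷ (+ 0 , + 2) ∷ (+ 0 , + 3)
           ∷ (+ 1 , + 1) ∷ (-[1+ 0 ] , + 1) ∷ []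

-- Elements of the dihedral group of order 8 acting on ℤ²:
-- (x , y) ↦ optionally swap coordinates, then optionally negate each coordinate.
record D4 : Set where
  constructor mkD4
  field
    swap  : Bool
    neg₁  : Bool
    neg₂  : Bool

negIf : Bool → ℤ → ℤ
negIf b z = if b then - z else z

act : D4 → ℤ × ℤ → ℤ × ℤ
act (mkD4 s a b) (x , y) =
  let p = if s then (y , x) else (x , y)
  in negIf a (proj₁ p) , negIf b (proj₂ p)

-- Cells of the torus ℤ/(4m+2) × ℤ/(4n+2), represented by canonical residues.
Cell : Set
Cell = ℕ × ℕ

IsCell : ℕ → ℕ → Cell → Set
IsCell m n (a , b) = (a < suc (4 * m + 1)) × (b < suc (4 * n + 1))

reduce : ℕ → ℕ → ℤ × ℤ → Cell
reduce m n (x , y) = (x %ℕ suc (4 * m + 1)) , (y %ℕ suc (4 * n + 1))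

Placement : Set
Placement = D4 × (ℤ × ℤ)

image : ℕ → ℕ → Polyomino → Placement → List Cell
image m n P (g , (v₁ , v₂)) =
  map (λ p → reduce m n ((proj₁ (act g p) +ℤ v₁) , (proj₂ (act g p) +ℤ v₂))) P

ValidPlacement : ℕ → ℕ → Polyomino → Placement → Set
ValidPlacement m n P pl = AllPairs (λ c d → ¬ c ≡ d) (image m n P pl)

_∈cells_ : Cell → List Cell → Set
c ∈cells cs = Any (c ≡_) cs

record Tiling (m n : ℕ) (P : Polyomino) : Set where
  field
    placements : List Placement
    valid      : (i : Fin (length placements)) →
                 ValidPlacement m n P (lookup placements i)
    cover      : (c : Cell) → IsCell m n c →
                 Σ (Fin (length placements)) λ i →
                   (c ∈cells image m n P (lookup placements i)) ×
                   ((j : Fin (length placements)) →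
                     c ∈cells image m n P (lookup placements j) → j ≡ i)

module Submission where

-- Colour a cell black when both of its coordinates are even.  The sides 4m+2 and 4n+2 are
-- even, so reduction to the torus preserves the parity of each coordinate; hence the black
-- cells covered by a placement g(P)+v are the images of the cells of P lying in a single
-- parity class of ℤ², determined by g and v.  Each of the four parity classes contains 0 or 2
-- cells of the X-hexomino, so every tile covers an even number of black cells, whereas the
-- torus has an odd number, (2m+1)(2n+1), of black cells.

open import Defs
open import Data.Bool using (Bool; true; false; if_then_else_)
open import Data.Fin using (Fin)
open import Data.Integer using (ℤ; +_; -[1+_]; ∣_∣; _%ℕ_; _/ℕ_; _⊖_)
  renaming (_+_ to _+ℤ_; _*_ to _*ℤ_)
open import Data.Integer.DivMod using (n%ℕd<d; a≡a%ℕn+[a/ℕn]*n)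
open import Data.Integer.Properties using (∣-i∣≡∣i∣; abs-*; [1+m]⊖[1+n]≡m⊖n)
open import Data.List
  using (List; []; _∷_; _++_; map; filter; concat; tabulate; applyUpTo; cartesianProduct; length; lookup)
open import Data.List.Membership.Propositional using (_∈_)
open import Data.List.Membership.Propositional.Properties
  using (∈-map⁻; ∈-filter⁺; ∈-filter⁻; ∈-concat⁺′; ∈-concat⁻′; ∈-tabulate⁺; ∈-tabulate⁻;
         ∈-applyUpTo⁺; ∈-applyUpTo⁻; ∈-cartesianProduct⁺; ∈-cartesianProduct⁻)
open import Data.List.Membership.Propositional.Properties.WithK using (unique∧set⇒bag)
open import Data.List.Properties using (length-++; length-map; length-applyUpTo; filter-≐)
open import Data.List.Relation.Binary.BagAndSetEquality using (∼bag⇒↭)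
open import Data.List.Relation.Binary.Permutation.Propositional.Properties using (↭-length)
open import Data.List.Relation.Unary.All using (All; []; _∷_)
import Data.List.Relation.Unary.All.Properties as All
import Data.List.Relation.Unary.AllPairs.Properties as AllPairs
open import Data.List.Relation.Unary.Unique.Propositional using (Unique)
import Data.List.Relation.Unary.Unique.Propositional.Properties as Unique
open import Data.Nat using (ℕ; zero; suc; _+_; _*_; _<_; NonZero; parity)
open import Data.Nat.Properties using (+-suc; *-monoʳ-<; *-cancelˡ-<; <⇒≢)
open import Data.Nat.Tactic.RingSolver using (solve-∀)
open import Data.Parity using (Parity; 0ℙ; 1ℙ) renaming (_+_ to _⊕_; _*_ to _⊗_)
import Data.Parity.Properties as ℙ
open import Data.Product using (_×_; _,_; proj₁; proj₂; ∃; swap)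
open import Data.Product.Properties using (≡-dec; ,-injective)
open import Function using (_∘_; _⇔_; mk⇔; Equivalence)
import Function.Properties.Equivalence as ⇔
open import Relation.Binary.PropositionalEquality
  using (_≡_; _≢_; refl; sym; trans; cong; cong₂; subst; module ≡-Reasoning)
open import Relation.Nullary using (¬_; Dec; does)
open import Relation.Unary using (Pred; Decidable; _≐_)

open ≡-Reasoning

ℤparity : ℤ → Parity
ℤparity i = parity ∣ i ∣

parity-suc+suc : ∀ m n → parity (suc m) ⊕ parity (suc n) ≡ parity m ⊕ parity n
parity-suc+suc m n = begin
  parity (suc m) ⊕ parity (suc n) ≡⟨ ℙ.+-homo-+ (suc m) (suc n) ⟨
  parity (suc m + suc n)          ≡⟨ cong (parity ∘ suc) (+-suc m n) ⟩
  parity (m + n)                  ≡⟨ ℙ.+-homo-+ m n ⟩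
  parity m ⊕ parity n             ∎

ℤparity-⊖ : ∀ m n → ℤparity (m ⊖ n) ≡ parity m ⊕ parity n
ℤparity-⊖ m       zero    = sym (ℙ.+-identityʳ (parity m))
ℤparity-⊖ zero    (suc n) = refl
ℤparity-⊖ (suc m) (suc n) = begin
  ℤparity (suc m ⊖ suc n)         ≡⟨ cong ℤparity ([1+m]⊖[1+n]≡m⊖n m n) ⟩
  ℤparity (m ⊖ n)                 ≡⟨ ℤparity-⊖ m n ⟩
  parity m ⊕ parity n             ≡⟨ parity-suc+suc m n ⟨
  parity (suc m) ⊕ parity (suc n) ∎

ℤparity-+ : ∀ i j → ℤparity (i +ℤ j) ≡ ℤparity i ⊕ ℤparity j
ℤparity-+ (+ m)    (+ n)    = ℙ.+-homo-+ m n
ℤparity-+ (+ m)    -[1+ n ] = ℤparity-⊖ m (suc n)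
ℤparity-+ -[1+ m ] (+ n)    = trans (ℤparity-⊖ n (suc m)) (ℙ.+-comm (parity n) _)
ℤparity-+ -[1+ m ] -[1+ n ] = trans (ℙ.+-homo-+ m n) (sym (parity-suc+suc m n))

ℤparity-negIf : ∀ b i → ℤparity (negIf b i) ≡ ℤparity i
ℤparity-negIf true  i = cong parity (∣-i∣≡∣i∣ i)
ℤparity-negIf false i = refl

ℤparity-%ℕ : ∀ i d .{{_ : NonZero d}} → parity d ≡ 0ℙ → parity (i %ℕ d) ≡ ℤparity i
ℤparity-%ℕ i d d-even = sym (begin
  ℤparity i                                    ≡⟨ cong ℤparity (a≡a%ℕn+[a/ℕn]*n i d) ⟩
  ℤparity (+ (i %ℕ d) +ℤ (i /ℕ d) *ℤ + d)      ≡⟨ ℤparity-+ (+ (i %ℕ d)) ((i /ℕ d) *ℤ + d) ⟩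
  parity (i %ℕ d) ⊕ ℤparity ((i /ℕ d) *ℤ + d)  ≡⟨ cong (parity (i %ℕ d) ⊕_) multiple-even ⟩
  parity (i %ℕ d) ⊕ 0ℙ                         ≡⟨ ℙ.+-identityʳ _ ⟩
  parity (i %ℕ d)                              ∎)
  where
  multiple-even : ℤparity ((i /ℕ d) *ℤ + d) ≡ 0ℙ
  multiple-even = begin
    ℤparity ((i /ℕ d) *ℤ + d)     ≡⟨ cong parity (abs-* (i /ℕ d) (+ d)) ⟩
    parity (∣ i /ℕ d ∣ * d)       ≡⟨ ℙ.*-homo-* ∣ i /ℕ d ∣ d ⟩
    parity ∣ i /ℕ d ∣ ⊗ parity d  ≡⟨ cong (parity ∣ i /ℕ d ∣ ⊗_) d-even ⟩
    parity ∣ i /ℕ d ∣ ⊗ 0ℙ        ≡⟨ ℙ.*-zeroʳ _ ⟩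
    0ℙ                            ∎

ParityClass : Set
ParityClass = Parity × Parity

_≟ᶜ_ : (c d : ParityClass) → Dec (c ≡ d)
_≟ᶜ_ = ≡-dec ℙ._≟_ ℙ._≟_

_⊕ᶜ_ : ParityClass → ParityClass → ParityClass
(p , q) ⊕ᶜ (r , s) = p ⊕ r , q ⊕ s

ℤclass : ℤ × ℤ → ParityClass
ℤclass (x , y) = ℤparity x , ℤparity y

cellClass : Cell → ParityClass
cellClass (a , b) = parity a , parity b

swapIf : Bool → ParityClass → ParityClass
swapIf s c = if s then swap c else c

ℤclass-+ : ∀ x y u v → ℤclass (x +ℤ u , y +ℤ v) ≡ ℤclass (x , y) ⊕ᶜ ℤclass (u , v)
ℤclass-+ x y u v = cong₂ _,_ (ℤparity-+ x u) (ℤparity-+ y v)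

ℤclass-act : ∀ g p → ℤclass (act g p) ≡ swapIf (D4.swap g) (ℤclass p)
ℤclass-act (mkD4 true  a b) (x , y) = cong₂ _,_ (ℤparity-negIf a y) (ℤparity-negIf b x)
ℤclass-act (mkD4 false a b) (x , y) = cong₂ _,_ (ℤparity-negIf a x) (ℤparity-negIf b y)

⊕-≡0ℙ⇔≡ : ∀ p q → p ⊕ q ≡ 0ℙ ⇔ p ≡ q
⊕-≡0ℙ⇔≡ p q = mk⇔
  (λ p⊕q≡0ℙ → sym (ℙ.+-cancelˡ-≡ p q p (trans p⊕q≡0ℙ (sym (ℙ.p+p≡0ℙ p)))))
  (λ { refl → ℙ.p+p≡0ℙ p })

⊕ᶜ-≡0⇔≡ : ∀ c d → c ⊕ᶜ d ≡ (0ℙ , 0ℙ) ⇔ c ≡ d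
⊕ᶜ-≡0⇔≡ (p , q) (r , s) = mk⇔
  (λ eq → let p⊕r≡0ℙ , q⊕s≡0ℙ = ,-injective eq in
    cong₂ _,_ (Equivalence.to (⊕-≡0ℙ⇔≡ p r) p⊕r≡0ℙ) (Equivalence.to (⊕-≡0ℙ⇔≡ q s) q⊕s≡0ℙ))
  (λ { refl → cong₂ _,_ (ℙ.p+p≡0ℙ p) (ℙ.p+p≡0ℙ q) })

swapIf-≡⇔ : ∀ s c d → swapIf s c ≡ d ⇔ c ≡ swapIf s d
swapIf-≡⇔ true  c d = mk⇔ (λ { refl → refl }) (λ { refl → refl })
swapIf-≡⇔ false c d = ⇔.refl

2*[1+2m]≡1+[4m+1] : ∀ m → 2 * suc (2 * m) ≡ suc (4 * m + 1)
2*[1+2m]≡1+[4m+1] = solve-∀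

torusSide-even : ∀ m → parity (suc (4 * m + 1)) ≡ 0ℙ
torusSide-even m = trans (cong parity (sym (2*[1+2m]≡1+[4m+1] m))) (ℙ.*-homo-* 2 (suc (2 * m)))

cellClass-reduce : ∀ m n z → cellClass (reduce m n z) ≡ ℤclass z
cellClass-reduce m n (x , y) =
  cong₂ _,_ (ℤparity-%ℕ x _ (torusSide-even m)) (ℤparity-%ℕ y _ (torusSide-even n))

placeCell : ℕ → ℕ → Placement → ℤ × ℤ → Cell
placeCell m n (g , (v₁ , v₂)) p = reduce m n (proj₁ (act g p) +ℤ v₁ , proj₂ (act g p) +ℤ v₂)

cellClass-placeCell : ∀ m n g v p →
  cellClass (placeCell m n (g , v) p) ≡ swapIf (D4.swap g) (ℤclass p) ⊕ᶜ ℤclass v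
cellClass-placeCell m n g (v₁ , v₂) p = begin
  cellClass (reduce m n (x +ℤ v₁ , y +ℤ v₂))
    ≡⟨ cellClass-reduce m n (x +ℤ v₁ , y +ℤ v₂) ⟩
  ℤclass (x +ℤ v₁ , y +ℤ v₂)
    ≡⟨ ℤclass-+ x y v₁ v₂ ⟩
  ℤclass (x , y) ⊕ᶜ ℤclass (v₁ , v₂)
    ≡⟨ cong (_⊕ᶜ ℤclass (v₁ , v₂)) (ℤclass-act g p) ⟩
  swapIf (D4.swap g) (ℤclass p) ⊕ᶜ ℤclass (v₁ , v₂)
    ∎
  where
  x y : ℤ
  x = proj₁ (act g p)
  y = proj₂ (act g p)

Black : Cell → Set
Black c = cellClass c ≡ (0ℙ , 0ℙ)

black? : Decidable Black
black? c = cellClass c ≟ᶜ (0ℙ , 0ℙ)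

classCount : Polyomino → ParityClass → ℕ
classCount P c = length (filter (_≟ᶜ c ∘ ℤclass) P)

filter-map : ∀ {a b q} {A : Set a} {B : Set b} {Q : Pred B q}
             (Q? : Decidable Q) (f : A → B) xs →
             filter Q? (map f xs) ≡ map f (filter (Q? ∘ f) xs)
filter-map Q? f []       = refl
filter-map Q? f (x ∷ xs) with does (Q? (f x))
... | true  = cong (f x ∷_) (filter-map Q? f xs)
... | false = filter-map Q? f xs

blackCount-image : ∀ m n P g v →
  length (filter black? (image m n P (g , v))) ≡ classCount P (swapIf (D4.swap g) (ℤclass v))
blackCount-image m n P g v = begin
  length (filter black? (map f P))
    ≡⟨ cong length (filter-map black? f P) ⟩
  length (map f (filter (black? ∘ f) P))
    ≡⟨ length-map f (filter (black? ∘ f) P) ⟩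
  length (filter (black? ∘ f) P)
    ≡⟨ cong length (filter-≐ (black? ∘ f) (_≟ᶜ c ∘ ℤclass) black⇔ P) ⟩
  classCount P c
    ∎
  where
  f : ℤ × ℤ → Cell
  f = placeCell m n (g , v)
  s : Bool
  s = D4.swap g
  c : ParityClass
  c = swapIf s (ℤclass v)
  black-f⇔ : ∀ p → Black (f p) ⇔ (ℤclass p ≡ c)
  black-f⇔ p = ⇔.trans (mk⇔ (trans (sym f-class)) (trans f-class))
    (⇔.trans (⊕ᶜ-≡0⇔≡ (swapIf s (ℤclass p)) (ℤclass v)) (swapIf-≡⇔ s (ℤclass p) (ℤclass v)))
    where
    f-class : cellClass (f p) ≡ swapIf s (ℤclass p) ⊕ᶜ ℤclass v
    f-class = cellClass-placeCell m n g v p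
  black⇔ : (Black ∘ f) ≐ ((_≡ c) ∘ ℤclass)
  black⇔ = (λ {p} → Equivalence.to (black-f⇔ p)) , (λ {p} → Equivalence.from (black-f⇔ p))

evensBelow : ℕ → List ℕ
evensBelow k = applyUpTo (2 *_) k

even⇒double : ∀ a → parity a ≡ 0ℙ → ∃ λ i → a ≡ 2 * i
even⇒double zero          _      = zero , refl
even⇒double (suc (suc a)) a-even with i , refl ← even⇒double a a-even =
  suc i , cong suc (sym (+-suc i (i + 0)))

∈-evensBelow⁺ : ∀ {a k} → a < 2 * k → parity a ≡ 0ℙ → a ∈ evensBelow k
∈-evensBelow⁺ {a} a<2k a-even with i , refl ← even⇒double a a-even =
  ∈-applyUpTo⁺ (2 *_) (*-cancelˡ-< 2 i _ a<2k)

∈-evensBelow⁻ : ∀ {a k} → a ∈ evensBelow k → a < 2 * k × parity a ≡ 0ℙ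
∈-evensBelow⁻ a∈ with i , i<k , refl ← ∈-applyUpTo⁻ (2 *_) a∈ =
  *-monoʳ-< 2 i<k , ℙ.*-homo-* 2 i

evensBelow-unique : ∀ k → Unique (evensBelow k)
evensBelow-unique k = Unique.applyUpTo⁺₁ (2 *_) k (λ i<j _ → <⇒≢ (*-monoʳ-< 2 i<j))

length-cartesianProduct : ∀ {A B : Set} (xs : List A) (ys : List B) →
                          length (cartesianProduct xs ys) ≡ length xs * length ys
length-cartesianProduct []       ys = refl
length-cartesianProduct (x ∷ xs) ys = begin
  length (map (x ,_) ys ++ cartesianProduct xs ys)
    ≡⟨ length-++ (map (x ,_) ys) ⟩
  length (map (x ,_) ys) + length (cartesianProduct xs ys)
    ≡⟨ cong₂ _+_ (length-map (x ,_) ys) (length-cartesianProduct xs ys) ⟩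
  length ys + length xs * length ys
    ∎

torusBlack : ℕ → ℕ → List Cell
torusBlack m n = cartesianProduct (evensBelow (suc (2 * m))) (evensBelow (suc (2 * n)))

∈-torusBlack⁺ : ∀ {m n a b} → IsCell m n (a , b) → Black (a , b) → (a , b) ∈ torusBlack m n
∈-torusBlack⁺ {m} {n} {a} {b} (a<side , b<side) black =
  let a-even , b-even = ,-injective black in
  ∈-cartesianProduct⁺ (∈-evensBelow⁺ (subst (a <_) (sym (2*[1+2m]≡1+[4m+1] m)) a<side) a-even)
                      (∈-evensBelow⁺ (subst (b <_) (sym (2*[1+2m]≡1+[4m+1] n)) b<side) b-even)

∈-torusBlack⁻ : ∀ {m n a b} → (a , b) ∈ torusBlack m n → IsCell m n (a , b) × Black (a , b)
∈-torusBlack⁻ {m} {n} {a} {b} ab∈ =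
  let a∈ , b∈ = ∈-cartesianProduct⁻ (evensBelow (suc (2 * m))) (evensBelow (suc (2 * n))) ab∈
      a<side , a-even = ∈-evensBelow⁻ a∈
      b<side , b-even = ∈-evensBelow⁻ b∈ in
  (subst (a <_) (2*[1+2m]≡1+[4m+1] m) a<side , subst (b <_) (2*[1+2m]≡1+[4m+1] n) b<side) ,
  cong₂ _,_ a-even b-even

torusBlack-unique : ∀ m n → Unique (torusBlack m n)
torusBlack-unique m n =
  Unique.cartesianProduct⁺ (evensBelow-unique (suc (2 * m))) (evensBelow-unique (suc (2 * n)))

torusBlack-odd : ∀ m n → parity (length (torusBlack m n)) ≡ 1ℙ
torusBlack-odd m n = begin
  parity (length (torusBlack m n))
    ≡⟨ cong parity (length-cartesianProduct (evensBelow k) (evensBelow l)) ⟩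
  parity (length (evensBelow k) * length (evensBelow l))
    ≡⟨ cong₂ (λ a b → parity (a * b)) (length-applyUpTo (2 *_) k) (length-applyUpTo (2 *_) l) ⟩
  parity (k * l)
    ≡⟨ ℙ.*-homo-* k l ⟩
  parity k ⊗ parity l
    ≡⟨ cong₂ _⊗_ (odd m) (odd n) ⟩
  1ℙ
    ∎
  where
  k l : ℕ
  k = suc (2 * m)
  l = suc (2 * n)
  odd : ∀ j → parity (suc (2 * j)) ≡ 1ℙ
  odd j = trans (ℙ.+-homo-+ 1 (2 * j)) (cong (1ℙ ⊕_) (ℙ.*-homo-* 2 j))

image-IsCell : ∀ m n P pl {c} → c ∈ image m n P pl → IsCell m n c
image-IsCell m n P pl@(g , (v₁ , v₂)) c∈ with p , _ , refl ← ∈-map⁻ (placeCell m n pl) c∈ =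
  n%ℕd<d (proj₁ (act g p) +ℤ v₁) _ , n%ℕd<d (proj₂ (act g p) +ℤ v₂) _

length-concat-even : ∀ {A : Set} {xss : List (List A)} →
                     All (λ xs → parity (length xs) ≡ 0ℙ) xss → parity (length (concat xss)) ≡ 0ℙ
length-concat-even [] = refl
length-concat-even {xss = xs ∷ xss} (xs-even ∷ xss-even) = begin
  parity (length (xs ++ concat xss))
    ≡⟨ cong parity (length-++ xs) ⟩
  parity (length xs + length (concat xss))
    ≡⟨ ℙ.+-homo-+ (length xs) (length (concat xss)) ⟩
  parity (length xs) ⊕ parity (length (concat xss))
    ≡⟨ cong₂ _⊕_ xs-even (length-concat-even xss-even) ⟩
  0ℙ
    ∎

EvenOnParityClasses : Polyomino → Set
EvenOnParityClasses P = ∀ c → parity (classCount P c) ≡ 0ℙ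

module BlackCells {m n : ℕ} {P : Polyomino} (T : Tiling m n P) where
  open Tiling T

  tile : Fin (length placements) → List Cell
  tile i = image m n P (lookup placements i)

  blackParts : List Cell
  blackParts = concat (tabulate (filter black? ∘ tile))

  owner-unique : ∀ {c} i j → c ∈ tile i → c ∈ tile j → i ≡ j
  owner-unique {c} i j c∈i c∈j =
    let _ , _ , owner = cover c (image-IsCell m n P (lookup placements i) c∈i) in
    trans (owner i c∈i) (sym (owner j c∈j))

  blackParts-unique : Unique blackParts
  blackParts-unique = Unique.concat⁺
    (All.tabulate⁺ (λ i → Unique.filter⁺ black? (valid i)))
    (AllPairs.tabulate⁺ λ i≢j (c∈i , c∈j) →
      i≢j (owner-unique _ _ (proj₁ (∈-filter⁻ black? c∈i)) (proj₁ (∈-filter⁻ black? c∈j))))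

  ∈-blackParts⇔ : ∀ {c} → c ∈ blackParts ⇔ c ∈ torusBlack m n
  ∈-blackParts⇔ {a , b} = mk⇔ covered covering
    where
    covered : (a , b) ∈ blackParts → (a , b) ∈ torusBlack m n
    covered c∈ =
      let _ , c∈part , part∈ = ∈-concat⁻′ (tabulate (filter black? ∘ tile)) c∈
          i , part≡ = ∈-tabulate⁻ part∈
          c∈i , black = ∈-filter⁻ black? (subst ((a , b) ∈_) part≡ c∈part) in
      ∈-torusBlack⁺ {m} {n} (image-IsCell m n P (lookup placements i) c∈i) black
    covering : (a , b) ∈ torusBlack m n → (a , b) ∈ blackParts
    covering c∈ =
      let isCell , black = ∈-torusBlack⁻ {m} {n} c∈
          i , c∈i , _ = cover (a , b) isCell in
      ∈-concat⁺′ (∈-filter⁺ black? c∈i black) (∈-tabulate⁺ i)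

  blackParts-length : length blackParts ≡ length (torusBlack m n)
  blackParts-length =
    ↭-length (∼bag⇒↭ (unique∧set⇒bag blackParts-unique (torusBlack-unique m n) ∈-blackParts⇔))

  blackParts-even : EvenOnParityClasses P → parity (length blackParts) ≡ 0ℙ
  blackParts-even P-even = length-concat-even (All.tabulate⁺ λ i →
    let g , v = lookup placements i in
    trans (cong parity (blackCount-image m n P g v)) (P-even (swapIf (D4.swap g) (ℤclass v))))

EvenOnParityClasses⇒¬Tiling : ∀ m n P → EvenOnParityClasses P → ¬ Tiling m n P
EvenOnParityClasses⇒¬Tiling m n P P-even T = 0ℙ≢1ℙ (begin
  0ℙ                                   ≡⟨ blackParts-even P-even ⟨
  parity (length blackParts)           ≡⟨ cong parity blackParts-length ⟩
  parity (length (torusBlack m n))     ≡⟨ torusBlack-odd m n ⟩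
  1ℙ                                   ∎)
  where
  open BlackCells T
  0ℙ≢1ℙ : 0ℙ ≢ 1ℙ
  0ℙ≢1ℙ ()

X-hexomino-even : EvenOnParityClasses X-hexomino
X-hexomino-even (0ℙ , 0ℙ) = refl
X-hexomino-even (0ℙ , 1ℙ) = refl
X-hexomino-even (1ℙ , 0ℙ) = refl
X-hexomino-even (1ℙ , 1ℙ) = refl

theorem3p3 : (m n : ℕ) → ¬ Tiling m n X-hexomino
theorem3p3 m n = EvenOnParityClasses⇒¬Tiling m n X-hexomino X-hexomino-even
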